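{- Let $\mathrm{XORUnification}$ be the XOR-unification algorithm described in the context. For every unification problem $P$ and every substitution $\sigma$, if $\mathrm{XORUnification}(P)$ returns $\sigma$, then $\sigma$ is idempotent: $\sigma(\sigma(x))\approx_{XOR}\sigma(x)$ for every variable $x$.
   Context: Terms are built from constants $C(n)$ ($n\in\mathbb{N}$), variables (indexed by strings), and a binary operator $\oplus$; the constant $0:=C(0)$ is the unit. The relation $\approx_{XOR}$ is the smallest congruence on terms (reflexive, symmetric, transitive, compatible with $\oplus$) containing associativity $(x\oplus y)\oplus z\approx x\oplus(y\oplus z)$, commutativity $x\oplus y\approx y\oplus x$, unity $0\oplus x\approx x$ and nilpotency $x\oplus x\approx 0$. A substitution maps variables to terms (identity on all but finitely many) and is extended homomorphically to terms. A unification problem is a finite list of equations $s\approx^? t$. The algorithm $\mathrm{XORUnification}$: each equation $s\approx^?t$ is rewritten as $s\oplus t\approx^?0$ and the left side is put in a normal form modulo $\approx_{XOR}$ (a list of atoms with cancelled duplicate pairs and removed $0$'s); one starts with the pair $\Gamma\|\Lambda$ with $\Gamma$ these equations and $\Lambda=\emptyset$, and repeatedly applies the first applicable of the rules (Trivial) $\Gamma\cup\{0\approx^?0\}\|\Lambda\ \Rightarrow\ \Gamma\|\Lambda$ and (Variable Substitution) $\Gamma\cup\{x\oplus S\approx^?0\}\|\Lambda\ \Rightarrow\ \sigma\Gamma\|\sigma\Lambda\cup\{x\approx^?S\}$, where $x$ is a variable not occurring in $S$ and $\sigma=\{x\mapsto S\}$ (results re-normalized). When no rule applies, if $\Gamma$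 is empty the algorithm returns the substitution $\{x\mapsto S : (x\approx^?S)\in\Lambda\}$, and otherwise returns None. -}

module Defs where

open import Data.Nat using (ℕ; zero; suc)
import Data.Nat as ℕ
open import Data.String using (String)
import Data.String as Str
open import Data.List using (List; []; _∷_; _++_; foldr; map; length)
open import Data.Maybe using (Maybe; just; nothing)
open import Data.Product using (_×_; _,_)
open import Relation.Nullary using (yes; no)
open import Data.Bool using (Bool; true; false; if_then_else_)

infixl 6 _⊕_

data Term : Set where
  C   : ℕ → Term
  V   : String → Term
  _⊕_ : Term → Term → Term

𝟘 : Term
𝟘 = C 0

infix 4 _≈X_

data _≈X_ : Term → Term → Set where
  refl≈  : ∀ {s} → s ≈X s
  sym≈   : ∀ {s t} → s ≈X t → t ≈X s
  trans≈ : ∀ {s t u} → s ≈X t → t ≈X u → s ≈X u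
  cong⊕  : ∀ {s s′ t t′} → s ≈X s′ → t ≈X t′ → (s ⊕ t) ≈X (s′ ⊕ t′)
  assoc  : ∀ x y z → ((x ⊕ y) ⊕ z) ≈X (x ⊕ (y ⊕ z))
  comm   : ∀ x y → (x ⊕ y) ≈X (y ⊕ x)
  unit   : ∀ x → (𝟘 ⊕ x) ≈X x
  nilp   : ∀ x → (x ⊕ x) ≈X 𝟘

-- Substitutions (identity outside finitely many variables; the ones
-- produced by the algorithm are of this form) and their homomorphic
-- extension to terms.

Subst : Set
Subst = String → Term

applyS : Subst → Term → Term
applyS σ (C n)   = C n
applyS σ (V x)   = σ x
applyS σ (s ⊕ t) = applyS σ s ⊕ applyS σ t

⟨_↦_⟩ : String → Term → Subst
⟨ x ↦ S ⟩ y with x Str.≟ y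
... | yes _ = S
... | no  _ = V y

-- Normal form modulo ≈XOR: list of atoms, duplicate pairs cancelled,
-- 0's removed.

data Atom : Set where
  cst : ℕ → Atom      -- nonzero constant
  var : String → Atom

_==A_ : Atom → Atom → Bool
cst m ==A cst n = m ℕ.≡ᵇ n
cst _ ==A var _ = false
var _ ==A cst _ = false
var x ==A var y = x Str.== y

atomTerm : Atom → Term
atomTerm (cst n) = C n
atomTerm (var x) = V x

flatten : Term → List Atom
flatten (C zero)    = []
flatten (C (suc n)) = cst (suc n) ∷ []
flatten (V x)       = var x ∷ []
flatten (s ⊕ t)     = flatten s ++ flatten t

toggle : Atom → List Atom → List Atom
toggle a []      = a ∷ []
toggle a (b ∷ l) = if a ==A b then l else (b ∷ toggle a l)

NF : Set
NF = List Atom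

norm : Term → NF
norm t = foldr toggle [] (flatten t)

nfTerm : NF → Term
nfTerm []          = 𝟘
nfTerm (a ∷ [])    = atomTerm a
nfTerm (a ∷ b ∷ l) = atomTerm a ⊕ nfTerm (b ∷ l)

UProblem : Set
UProblem = List (Term × Term)

-- Γ : equations  S ≈? 0  with S in normal form
-- Λ : solved equations x ≈? S
Solved : Set
Solved = List (String × Term)

findTrivial : List NF → Maybe (List NF)
findTrivial []            = nothing
findTrivial ([] ∷ Γ)      = just Γ
findTrivial ((a ∷ l) ∷ Γ) with findTrivial Γ
... | just Γ′ = just ((a ∷ l) ∷ Γ′)
... | nothing = nothing

-- first variable x of a normal form, together with the rest S
-- (in a normal form x does not occur in S, as duplicates are cancelled)
splitVar : NF → Maybe (String × NF)
splitVar []            = nothing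
splitVar (var x ∷ l)   = just (x , l)
splitVar (cst n ∷ l) with splitVar l
... | just (x , S) = just (x , cst n ∷ S)
... | nothing      = nothing

findVar : List NF → Maybe (String × NF × List NF)
findVar []      = nothing
findVar (e ∷ Γ) with splitVar e
... | just (x , S) = just (x , S , Γ)
... | nothing with findVar Γ
...   | just (x , S , Γ′) = just (x , S , e ∷ Γ′)
...   | nothing           = nothing

toSubst : Solved → Subst
toSubst []            y = V y
toSubst ((x , S) ∷ Λ) y = if x Str.== y then S else toSubst Λ y

-- Each rule removes one equation from Γ, so (length Γ) steps suffice;
-- the fuel argument is only a termination device.
run : ℕ → List NF → Solved → Maybe Subst
run _ [] Λ = just (toSubst Λ)
run zero (_ ∷ _) Λ = nothing
run (suc k) Γ Λ with findTrivial Γ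
... | just Γ′ = run k Γ′ Λ
... | nothing with findVar Γ
...   | nothing = nothing
...   | just (x , S , Γ′) =
          let σ = ⟨ x ↦ nfTerm S ⟩ in
          run k (map (λ e → norm (applyS σ (nfTerm e))) Γ′)
                (map (λ { (y , T) → (y , nfTerm (norm (applyS σ T))) }) Λ
                   ++ ((x , nfTerm S) ∷ []))

XORUnification : UProblem → Maybe Subst
XORUnification P =
  let Γ = map (λ { (s , t) → norm (s ⊕ t) }) P in
  run (length Γ) Γ []

module Submission where

-- The algorithm maintains the invariant that every solved variable x of Λ
-- occurs neither in a pending equation of Γ nor in any solved right-hand
-- side.  (Variable Substitution) preserves it: a normal form has no
-- repeated atoms, so x does not occur in S, and {x ↦ S} therefore removes
-- x everywhere; the earlier solved variables do not occur in S, so the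
-- substitution cannot reintroduce them.  On termination Γ is empty, and the
-- returned σ maps every variable to a term in which no variable bound by σ
-- occurs, so σ fixes every σ(x) — even syntactically.

open import Defs
open import Data.String using (String)
open import Data.Maybe using (just)
open import Relation.Binary.PropositionalEquality using (_≡_)

import Data.String as Str
open import Data.Maybe using (nothing)
open import Data.Nat using (zero; suc)
open import Data.Nat.Properties using (≡⇒≡ᵇ)
open import Data.List using (List; []; _∷_; _++_; foldr; map)
open import Data.Product using (_×_; _,_; proj₁; proj₂; ∃)
open import Data.Sum using (_⊎_; inj₁; inj₂)
open import Data.Unit using (⊤; tt)
open import Data.Bool using (T; true; false)
open import Function using (_∘_)
open import Relation.Nullary using (yes; no; contradiction)
open import Relation.Nullary.Decidable using (fromWitness)
open import Relation.Binary.PropositionalEquality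
  using (_≢_; refl; sym; cong; cong₂; subst; ≢-sym; module ≡-Reasoning)
open import Data.List.Relation.Unary.All as All using (All; []; _∷_)
open import Data.List.Relation.Unary.All.Properties using (map⁺; ++⁺)
open import Data.List.Relation.Unary.AllPairs using ([]; _∷_)
open import Data.List.Relation.Unary.Unique.Propositional using (Unique)
open import Data.List.Relation.Unary.Any using (here; there)
open import Data.List.Membership.Propositional using (_∈_)

infix 4 _∉ₜ_ _∉ₙ_

_∉ₜ_ : String → Term → Set
z ∉ₜ C n   = ⊤
z ∉ₜ V y   = z ≢ y
z ∉ₜ s ⊕ t = z ∉ₜ s × z ∉ₜ t

_∉ₙ_ : String → NF → Set
z ∉ₙ l = All (var z ≢_) l

==A-reflexive : ∀ {a b} → a ≡ b → T (a ==A b)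
==A-reflexive {cst m} refl = ≡⇒≡ᵇ m m refl
==A-reflexive {var x} refl = fromWitness {a? = x Str.≟ x} refl

==A-false⇒≢ : ∀ {a b} → (a ==A b) ≡ false → a ≢ b
==A-false⇒≢ eq a≡b = subst T eq (==A-reflexive a≡b)

toggle⁺ : ∀ {P : Atom → Set} {a} l → P a → All P l → All P (toggle a l)
toggle⁺ []      pa []         = pa ∷ []
toggle⁺ {a = a} (b ∷ l) pa (pb ∷ pl) with a ==A b
... | true  = pl
... | false = pb ∷ toggle⁺ l pa pl

toggle-Unique : ∀ a l → Unique l → Unique (toggle a l)
toggle-Unique a []      []        = [] ∷ []
toggle-Unique a (b ∷ l) (b∉l ∷ l!) with a ==A b in a≠b
... | true  = l!
... | false = toggle⁺ l (≢-sym (==A-false⇒≢ a≠b)) b∉l ∷ toggle-Unique a l l!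

norm⁺ : ∀ {P : Atom → Set} t → All P (flatten t) → All P (norm t)
norm⁺ t = go (flatten t)
  where
  go : ∀ {P : Atom → Set} l → All P l → All P (foldr toggle [] l)
  go []      []        = []
  go (a ∷ l) (pa ∷ pl) = toggle⁺ (foldr toggle [] l) pa (go l pl)

norm-Unique : ∀ t → Unique (norm t)
norm-Unique t = go (flatten t)
  where
  go : ∀ l → Unique (foldr toggle [] l)
  go []      = []
  go (a ∷ l) = toggle-Unique a _ (go l)

∉-flatten : ∀ {z} t → z ∉ₜ t → z ∉ₙ flatten t
∉-flatten (C zero)    _           = []
∉-flatten (C (suc n)) _           = (λ ()) ∷ []
∉-flatten (V y)       z≢y         = (λ { refl → z≢y refl }) ∷ []
∉-flatten (s ⊕ t)     (z∉s , z∉t) = ++⁺ (∉-flatten s z∉s) (∉-flatten t z∉t)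

∉-norm : ∀ {z} t → z ∉ₜ t → z ∉ₙ norm t
∉-norm t z∉t = norm⁺ t (∉-flatten t z∉t)

∉-atomTerm : ∀ {z} a → var z ≢ a → z ∉ₜ atomTerm a
∉-atomTerm (cst n) _   = tt
∉-atomTerm (var y) z≢y = λ { refl → z≢y refl }

∉-nfTerm : ∀ {z} l → z ∉ₙ l → z ∉ₜ nfTerm l
∉-nfTerm []          []          = tt
∉-nfTerm (a ∷ [])    (z≢a ∷ [])  = ∉-atomTerm a z≢a
∉-nfTerm (a ∷ b ∷ l) (z≢a ∷ z∉l) = ∉-atomTerm a z≢a , ∉-nfTerm (b ∷ l) z∉l

∉-applyS-↦ : ∀ {z x S} t → z ∉ₜ S → z ∉ₜ t → z ∉ₜ applyS ⟨ x ↦ S ⟩ t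
∉-applyS-↦     (C n)   _   _           = tt
∉-applyS-↦ {x = x} (V y) z∉S z≢y with x Str.≟ y
... | yes _ = z∉S
... | no  _ = z≢y
∉-applyS-↦     (s ⊕ t) z∉S (z∉s , z∉t) = ∉-applyS-↦ s z∉S z∉s , ∉-applyS-↦ t z∉S z∉t

∉-applyS-↦-self : ∀ {x S} t → x ∉ₜ S → x ∉ₜ applyS ⟨ x ↦ S ⟩ t
∉-applyS-↦-self         (C n)   _   = tt
∉-applyS-↦-self {x = x} (V y)   x∉S with x Str.≟ y
... | yes _   = x∉S
... | no  x≢y = x≢y
∉-applyS-↦-self         (s ⊕ t) x∉S = ∉-applyS-↦-self s x∉S , ∉-applyS-↦-self t x∉S

splitVar⁺ : ∀ {P : Atom → Set} e {x S} → All P e → splitVar e ≡ just (x , S) → All P S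
splitVar⁺ (var y ∷ l) (_ ∷ pl) refl = pl
splitVar⁺ (cst n ∷ l) (pn ∷ pl) found with splitVar l in split
splitVar⁺ (cst n ∷ l) (pn ∷ pl) refl | just _ = pn ∷ splitVar⁺ l pl split

splitVar-Unique : ∀ e {x S} → Unique e → splitVar e ≡ just (x , S) → x ∉ₙ S
splitVar-Unique (var y ∷ l) (y∉l ∷ _) refl = y∉l
splitVar-Unique (cst n ∷ l) (_ ∷ l!) found with splitVar l in split
splitVar-Unique (cst n ∷ l) (_ ∷ l!) refl | just _ = (λ ()) ∷ splitVar-Unique l l! split

findTrivial⁺ : ∀ {Q : NF → Set} Γ {Γ′} → All Q Γ → findTrivial Γ ≡ just Γ′ → All Q Γ′
findTrivial⁺ ([] ∷ Γ)      (_ ∷ qs) refl = qs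
findTrivial⁺ ((a ∷ l) ∷ Γ) (q ∷ qs) found with findTrivial Γ in found′
findTrivial⁺ ((a ∷ l) ∷ Γ) (q ∷ qs) refl | just _ = q ∷ findTrivial⁺ Γ qs found′

findVar-chosen : ∀ Γ {x S Γ′} → findVar Γ ≡ just (x , S , Γ′) →
                 ∃ λ e → e ∈ Γ × splitVar e ≡ just (x , S)
findVar-chosen (e ∷ Γ) found with splitVar e in split
findVar-chosen (e ∷ Γ) refl | just _ = e , here refl , split
... | nothing with findVar Γ in found′
findVar-chosen (e ∷ Γ) refl | nothing | just _ =
  let e′ , e′∈Γ , split′ = findVar-chosen Γ found′ in e′ , there e′∈Γ , split′

findVar⁺ : ∀ {Q : NF → Set} Γ {x S Γ′} → All Q Γ → findVar Γ ≡ just (x , S , Γ′) → All Q Γ′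
findVar⁺ (e ∷ Γ) (q ∷ qs) found with splitVar e
findVar⁺ (e ∷ Γ) (q ∷ qs) refl | just _ = qs
... | nothing with findVar Γ in found′
findVar⁺ (e ∷ Γ) (q ∷ qs) refl | nothing | just _ = q ∷ findVar⁺ Γ qs found′

Eliminated : List NF → Solved → String → Set
Eliminated Γ Λ z = All (z ∉ₙ_) Γ × All ((z ∉ₜ_) ∘ proj₂) Λ

Invariant : List NF → Solved → Set
Invariant Γ Λ = All (Eliminated Γ Λ ∘ proj₁) Λ × All Unique Γ

module _ (x : String) (S : NF) where

  substEqs : List NF → List NF
  substEqs = map (λ e → norm (applyS ⟨ x ↦ nfTerm S ⟩ (nfTerm e)))

  substSolved : Solved → Solved
  substSolved = map (λ q → proj₁ q , nfTerm (norm (applyS ⟨ x ↦ nfTerm S ⟩ (proj₂ q))))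

  substEqs-Unique : ∀ Γ → All Unique (substEqs Γ)
  substEqs-Unique Γ = map⁺ (All.tabulate λ {e} _ → norm-Unique (applyS ⟨ x ↦ nfTerm S ⟩ (nfTerm e)))

  substEqs-∉ : ∀ {z} Γ → z ∉ₜ nfTerm S → All (z ∉ₙ_) Γ → All (z ∉ₙ_) (substEqs Γ)
  substEqs-∉ Γ z∉S =
    map⁺ ∘ All.map λ {e} z∉e → ∉-norm _ (∉-applyS-↦ (nfTerm e) z∉S (∉-nfTerm e z∉e))

  substSolved-∉ : ∀ {z} Λ → z ∉ₜ nfTerm S → All ((z ∉ₜ_) ∘ proj₂) Λ →
                  All ((z ∉ₜ_) ∘ proj₂) (substSolved Λ)
  substSolved-∉ Λ z∉S =
    map⁺ ∘ All.map λ {q} z∉q → ∉-nfTerm _ (∉-norm _ (∉-applyS-↦ (proj₂ q) z∉S z∉q))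

  substEqs-eliminates : ∀ Γ → x ∉ₜ nfTerm S → All (x ∉ₙ_) (substEqs Γ)
  substEqs-eliminates Γ x∉S =
    map⁺ (All.tabulate λ {e} _ → ∉-norm _ (∉-applyS-↦-self (nfTerm e) x∉S))

  substSolved-eliminates : ∀ Λ → x ∉ₜ nfTerm S → All ((x ∉ₜ_) ∘ proj₂) (substSolved Λ)
  substSolved-eliminates Λ x∉S =
    map⁺ (All.tabulate λ {q} _ → ∉-nfTerm _ (∉-norm _ (∉-applyS-↦-self (proj₂ q) x∉S)))

trivial-preserves : ∀ {Γ Γ′ Λ} → Invariant Γ Λ → findTrivial Γ ≡ just Γ′ → Invariant Γ′ Λ
trivial-preserves {Γ} (elim , uniq) found =
  All.map (λ (z∉Γ , z∉Λ) → findTrivial⁺ Γ z∉Γ found , z∉Λ) elim , findTrivial⁺ Γ uniq found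

varSubst-preserves : ∀ {Γ Λ x S Γ′} → Invariant Γ Λ → findVar Γ ≡ just (x , S , Γ′) →
  Invariant (substEqs x S Γ′) (substSolved x S Λ ++ (x , nfTerm S) ∷ [])
varSubst-preserves {Γ} {Λ} {x} {S} {Γ′} (elim , uniq) found =
  ++⁺ (map⁺ (All.map stays elim)) (eliminated ∷ []) ,
  substEqs-Unique x S Γ′
  where
  chosen : ∃ λ e → e ∈ Γ × splitVar e ≡ just (x , S)
  chosen = findVar-chosen Γ found

  ∉S : ∀ {z} → All (z ∉ₙ_) Γ → z ∉ₜ nfTerm S
  ∉S z∉Γ = let e , e∈Γ , split = chosen in
    ∉-nfTerm S (splitVar⁺ e (All.lookup z∉Γ e∈Γ) split)

  x∉S : x ∉ₜ nfTerm S
  x∉S = let e , e∈Γ , split = chosen in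
    ∉-nfTerm S (splitVar-Unique e (All.lookup uniq e∈Γ) split)

  eliminated : Eliminated (substEqs x S Γ′) (substSolved x S Λ ++ (x , nfTerm S) ∷ []) x
  eliminated = substEqs-eliminates x S Γ′ x∉S ,
               ++⁺ (substSolved-eliminates x S Λ x∉S) (x∉S ∷ [])

  stays : ∀ {z} → Eliminated Γ Λ z →
          Eliminated (substEqs x S Γ′) (substSolved x S Λ ++ (x , nfTerm S) ∷ []) z
  stays (z∉Γ , z∉Λ) =
    substEqs-∉ x S Γ′ (∉S z∉Γ) (findVar⁺ Γ z∉Γ found) ,
    ++⁺ (substSolved-∉ x S Λ (∉S z∉Γ) z∉Λ) (∉S z∉Γ ∷ [])

toSubst-unbound : ∀ Λ {y} → All ((_≢ y) ∘ proj₁) Λ → toSubst Λ y ≡ V y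
toSubst-unbound []            []           = refl
toSubst-unbound ((x , S) ∷ Λ) {y} (x≢y ∷ Λ≢y) with x Str.≟ y
... | yes x≡y = contradiction x≡y x≢y
... | no  _   = toSubst-unbound Λ Λ≢y

toSubst-fixes : ∀ Λ t → All ((_∉ₜ t) ∘ proj₁) Λ → applyS (toSubst Λ) t ≡ t
toSubst-fixes Λ (C n)   _      = refl
toSubst-fixes Λ (V y)   Λ∉y    = toSubst-unbound Λ Λ∉y
toSubst-fixes Λ (s ⊕ t) Λ∉s⊕t =
  cong₂ _⊕_ (toSubst-fixes Λ s (All.map proj₁ Λ∉s⊕t)) (toSubst-fixes Λ t (All.map proj₂ Λ∉s⊕t))

toSubst-lookup : ∀ Λ y → toSubst Λ y ≡ V y ⊎ ∃ λ q → q ∈ Λ × toSubst Λ y ≡ proj₂ q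
toSubst-lookup []            y = inj₁ refl
toSubst-lookup ((x , S) ∷ Λ) y with x Str.== y | toSubst-lookup Λ y
... | true  | _                     = inj₂ (_ , here refl , refl)
... | false | inj₁ unbound          = inj₁ unbound
... | false | inj₂ (q , q∈Λ , σy≡q) = inj₂ (q , there q∈Λ , σy≡q)

toSubst-idempotent : ∀ Λ → All (λ p → All ((proj₁ p ∉ₜ_) ∘ proj₂) Λ) Λ →
                     ∀ y → applyS (toSubst Λ) (toSubst Λ y) ≡ toSubst Λ y
toSubst-idempotent Λ dom∉rhs y with toSubst-lookup Λ y
... | inj₁ unbound = cong (applyS (toSubst Λ)) unbound
... | inj₂ (q , q∈Λ , σy≡q) = begin
  applyS (toSubst Λ) (toSubst Λ y) ≡⟨ cong (applyS (toSubst Λ)) σy≡q ⟩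
  applyS (toSubst Λ) (proj₂ q)     ≡⟨ toSubst-fixes Λ (proj₂ q) (All.map (λ p∉ → All.lookup p∉ q∈Λ) dom∉rhs) ⟩
  proj₂ q                          ≡⟨ sym σy≡q ⟩
  toSubst Λ y                      ∎
  where open ≡-Reasoning

run-idempotent : ∀ k Γ Λ {σ} → Invariant Γ Λ → run k Γ Λ ≡ just σ →
                 ∀ y → applyS σ (σ y) ≡ σ y
run-idempotent k       []      Λ (elim , _) refl = toSubst-idempotent Λ (All.map proj₂ elim)
run-idempotent zero    (_ ∷ _) Λ _ ()
run-idempotent (suc k) (e ∷ Γ) Λ inv returns with findTrivial (e ∷ Γ) in trivial
... | just Γ′ = run-idempotent k Γ′ Λ (trivial-preserves inv trivial) returns
... | nothing with findVar (e ∷ Γ) in found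
...   | just (x , S , Γ′) =
        run-idempotent k (substEqs x S Γ′) _ (varSubst-preserves inv found) returns

≡⇒≈X : ∀ {s t} → s ≡ t → s ≈X t
≡⇒≈X refl = refl≈

mainTheorem3 : (P : UProblem) (σ : Subst) → XORUnification P ≡ just σ →
    (x : String) → applyS σ (σ x) ≈X σ x
mainTheorem3 P σ returns x = ≡⇒≈X (run-idempotent _ _ [] ([] , initial-Unique P) returns x)
  where
  initial-Unique : ∀ P → All Unique (map (λ { (s , t) → norm (s ⊕ t) }) P)
  initial-Unique []            = []
  initial-Unique ((s , t) ∷ P) = norm-Unique (s ⊕ t) ∷ initial-Unique P
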